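{- Let $P$ be a finite graded poset with minimum $\hat0$ and let $\lambda$ be a generalized EW-labeling of $P$. For each $k$ there is a bijection between the set of saturated chains of length $k$ starting at $[\hat0]$ (the class of the chain $\{\hat0\}$) in $Q_\lambda(P)$ and the set of saturated chains of length $k$ starting at $\hat0$ in $P$. This bijection maps each chain to a chain with the same word of labels, where chains of $Q_\lambda(P)$ are labeled by $\lambda^*$ and chains of $P$ by $\lambda$. In particular, there is a label-preserving bijection between the maximal chains of $Q_\lambda(P)$ and the maximal chains of $P$.
   Context: All posets are finite and graded with minimum $\hat0$; $\mathcal M_{[x,y]}$ is the set of maximal chains of $[x,y]$. An edge labeling is a map $\lambda$ from the cover relations of $P$ to a poset $\Lambda$. A saturated chain $x_0\lessdot\cdots\lessdot x_\ell$ has word of labels $\lambda(x_0\lessdot x_1)\cdots\lambda(x_{\ell-1}\lessdot x_\ell)$ and an ascent at $i$ if $\lambda(x_{i-1}\lessdot x_i)<\lambda(x_i\lessdot x_{i+1})$. ER-labeling: every closed interval has exactly one maximal chain with ascents at all positions. Rank two switching property: every maximal chain of $P$ with an ascent at rank $i$ has a unique partner maximal chain that differs only at rank $i$ and has the labels at ranks $i$ and $i+1$ swapped. This gives the quadratic exchange $U_i(\mathbf c)$ for saturated chains $\mathbf c$ with an ascent at $i$; set $U_i(\mathbf c)=\mathbf c$ otherwise. Braid relation: $U_iU_{i+1}U_i(\mathbf c)=U_{i+1}U_iU_{i+1}(\mathbf c)$ for every saturated chain $\mathbf c$ with ascents at $i$ and $i+1$. $\mathbf c_1\sim_\lambda\mathbf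 c_2$ for $\mathbf c_1,\mathbf c_2\in\mathcal M_{[x,y]}$ means they are related by a finite sequence of quadratic exchanges and their inverses. Cancellative property: for $z<x<y$, $\mathbf c\in\mathcal M_{[z,x]}$ and $\mathbf c_1,\mathbf c_2\in\mathcal M_{[x,y]}$, $\mathbf c\cup\mathbf c_1\sim_\lambda\mathbf c\cup\mathbf c_2$ implies $\mathbf c_1\sim_\lambda\mathbf c_2$. A generalized EW-labeling is an ER-labeling with the rank two switching property, the braid relation and the cancellative property. $Q_\lambda(P)$. $C(P)$ is the set of saturated chains from $\hat0$ ordered by inclusion, with top element $e(\mathbf c)$. Two chains are equivalent if they have the same top $y$ and are $\sim_\lambda$-related in $\mathcal M_{[\hat0,y]}$. $Q_\lambda(P)$ is the set of classes, ordered by $X\le Y$ iff $\mathbf x=\mathbf z_0\le\mathbf z_1\sim\mathbf z_2\le\cdots\sim\mathbf z_{2k}\le\mathbf z_{2k+1}=\mathbf y$ for some $\mathbf x\in X$, $\mathbf y\in Y$, $\mathbf z_j\in C(P)$. $S(X)$ is the multiset of labels of any chain in $X$ (well defined). The labeling $\lambda^*$ of $Q_\lambda(P)$ is given by $\lambda^*(X\lessdot Y)=$ the unique element of the multiset difference $S(Y)\setminus S(X)$. -}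

module Defs where

open import Level using (0ℓ)
open import Data.Nat using (ℕ; zero; suc)
open import Data.Fin using (Fin)
open import Data.List using (List; []; _∷_; _++_; length; drop)
open import Data.List.Membership.Propositional using (_∈_)
open import Data.List.Relation.Unary.Linked using (Linked; [-])
open import Data.List.Relation.Binary.Pointwise as PW using (Pointwise)
open import Data.List.Relation.Binary.Permutation.Propositional using (_↭_)
open import Data.Product using (Σ; _×_; _,_; proj₁; proj₂)
open import Data.Sum using (_⊎_)
open import Relation.Nullary using (¬_)
open import Relation.Binary using (Rel; IsPartialOrder; Decidable; Setoid; IsEquivalence)
open import Relation.Binary.PropositionalEquality using (_≡_; _≢_; refl; sym; trans)
import Relation.Binary.PropositionalEquality as Eq
open import Relation.Binary.Construct.Closure.Equivalence as EqC using (EqClosure)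

-- The labeling is a total function P → P → Λ; only its values on cover
-- relations x ⋖ y are ever used.

record LabeledPoset : Set₁ where
  field
    n               : ℕ
    _≤_             : Rel (Fin n) 0ℓ
    isPartialOrder  : IsPartialOrder _≡_ _≤_
    _≤?_            : Decidable _≤_
    bot             : Fin n
    Lab             : Set
    _≤ᴸ_            : Rel Lab 0ℓ
    isPartialOrderᴸ : IsPartialOrder _≡_ _≤ᴸ_
    lab             : Fin n → Fin n → Lab

last⁺ : {A : Set} → A → List A → A
last⁺ x []       = x
last⁺ x (y ∷ ys) = last⁺ y ys

module _ (D : LabeledPoset) where
  open LabeledPoset D

  P : Set
  P = Fin n

  _<_ : Rel P 0ℓ
  x < y = x ≤ y × x ≢ y

  _⋖_ : Rel P 0ℓ
  x ⋖ y = x < y × (∀ z → ¬ (x < z × z < y))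

  _<ᴸ_ : Rel Lab 0ℓ
  a <ᴸ b = a ≤ᴸ b × a ≢ b

  IsMinimum : Set
  IsMinimum = ∀ x → bot ≤ x

  IsGraded : Set
  IsGraded = Σ (P → ℕ) λ ρ → ρ bot ≡ 0 × (∀ x y → x ⋖ y → ρ y ≡ suc (ρ x))

  word : List P → List Lab
  word []           = []
  word (x ∷ [])     = []
  word (x ∷ y ∷ r)  = lab x y ∷ word (y ∷ r)

  -- c is a maximal chain of the interval [x,y], i.e. a saturated chain x ⋖ ⋯ ⋖ y
  MC : P → P → List P → Set
  MC x y c = Σ (List P) λ xs → c ≡ x ∷ xs × Linked _⋖_ c × last⁺ x xs ≡ y

  MaximalChain : List P → Set
  MaximalChain c = Σ P λ y → MC bot y c × (∀ z → ¬ (y < z))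

  Rising : List P → Set
  Rising c = Linked _<ᴸ_ (word c)

  IsER : Set
  IsER = ∀ x y → x ≤ y →
    Σ (List P) λ c → MC x y c × Rising c × (∀ d → MC x y d → Rising d → d ≡ c)

  -- ascent at i: λ(x_{i-1} ⋖ x_i) < λ(x_i ⋖ x_{i+1})   (x_j at list index j)
  Ascent : ℕ → List P → Set
  Ascent i c = Σ (List P) λ p → Σ P λ u → Σ P λ x → Σ P λ y → Σ (List P) λ s →
    c ≡ p ++ u ∷ x ∷ y ∷ s × suc (length p) ≡ i × lab u x <ᴸ lab x y

  -- c' differs from c only at rank (index) i, and the labels at ranks i and
  -- i+1 (word positions i-1 and i) are swapped
  Partner : ℕ → List P → List P → Set
  Partner i c c' =
    (Σ (List P) λ p → Σ P λ x → Σ P λ x' → Σ (List P) λ s →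
       c ≡ p ++ x ∷ s × c' ≡ p ++ x' ∷ s × length p ≡ i)
    × (Σ (List Lab) λ u → Σ Lab λ a → Σ Lab λ b → Σ (List Lab) λ v →
       word c ≡ u ++ a ∷ b ∷ v × word c' ≡ u ++ b ∷ a ∷ v × suc (length u) ≡ i)

  RankTwoSwitching : Set
  RankTwoSwitching = ∀ c → MaximalChain c → ∀ i → Ascent i c →
    Σ (List P) λ c' → MaximalChain c' × Partner i c c'
      × (∀ d → MaximalChain d → Partner i c d → d ≡ c')

  Exch : ℕ → List P → List P → Set
  Exch i c c' = Linked _⋖_ c × Linked _⋖_ c' × Ascent i c × Partner i c c'

  -- d = U_i(c)  (U_i(c) = c when c has no ascent at i)
  U : ℕ → List P → List P → Set
  U i c d = Exch i c d ⊎ (¬ Ascent i c × d ≡ c)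

  Braid : Set
  Braid = ∀ i c → Linked _⋖_ c → Ascent i c → Ascent (suc i) c →
    ∀ d₁ d₂ d₃ e₁ e₂ e₃ →
    U i c d₁ → U (suc i) d₁ d₂ → U i d₂ d₃ →
    U (suc i) c e₁ → U i e₁ e₂ → U (suc i) e₂ e₃ →
    d₃ ≡ e₃

  QExch : Rel (List P) 0ℓ
  QExch c d = Σ ℕ λ i → Exch i c d

  _∼_ : Rel (List P) 0ℓ
  _∼_ = EqClosure QExch

  -- c ∪ c₁ for c ∈ M[z,x], c₁ ∈ M[x,y]
  Cancellative : Set
  Cancellative = ∀ z x y c c₁ c₂ → z < x → x < y →
    MC z x c → MC x y c₁ → MC x y c₂ →
    (c ++ drop 1 c₁) ∼ (c ++ drop 1 c₂) → c₁ ∼ c₂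

  IsGeneralizedEW : Set
  IsGeneralizedEW = IsER × RankTwoSwitching × Braid × Cancellative

  IsC : List P → Set
  IsC c = Σ (List P) λ xs → c ≡ bot ∷ xs × Linked _⋖_ c

  C : Set
  C = Σ (List P) IsC

  e : List P → P
  e []       = bot
  e (x ∷ xs) = last⁺ x xs

  -- the equivalence defining the classes of Q_λ(P)
  _≈C_ : Rel C 0ℓ
  a ≈C b = e (proj₁ a) ≡ e (proj₁ b) × proj₁ a ∼ proj₁ b

  ≈C-isEquivalence : IsEquivalence _≈C_
  ≈C-isEquivalence = record
    { refl  = refl , EqC.isEquivalence QExch .IsEquivalence.refl
    ; sym   = λ (p , q) → sym p , EqC.isEquivalence QExch .IsEquivalence.sym q
    ; trans = λ (p , q) (p' , q') → trans p p' , EqC.isEquivalence QExch .IsEquivalence.trans q q'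
    }

  _⊆C_ : Rel C 0ℓ
  a ⊆C b = ∀ {x} → x ∈ proj₁ a → x ∈ proj₁ b

  data Zig : C → C → Set where
    base : ∀ {a b} → a ⊆C b → Zig a b
    step : ∀ {a b b' c} → a ⊆C b → b ≈C b' → Zig b' c → Zig a c

  -- order of Q_λ(P), on representatives
  _≤Q_ : Rel C 0ℓ
  a ≤Q b = Σ C λ x → Σ C λ y → x ≈C a × y ≈C b × Zig x y

  _<Q_ : Rel C 0ℓ
  a <Q b = a ≤Q b × ¬ (a ≈C b)

  _⋖Q_ : Rel C 0ℓ
  a ⋖Q b = a <Q b × (∀ z → ¬ (a <Q z × z <Q b))

  botC : C
  botC = bot ∷ [] , [] , refl , [-]

  S : C → List Lab
  S X = word (proj₁ X)

  -- LabStar Xs w : w is the λ*-word of the chain X₀ ⋖ ⋯ ⋖ X_k of Q_λ(P),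
  -- λ*(X ⋖ Y) = a meaning the multiset S(Y) is S(X) plus the element a.
  data LabStar : List C → List Lab → Set where
    one  : ∀ {X} → LabStar (X ∷ []) []
    step : ∀ {X Y Zs a w} → S Y ↭ a ∷ S X → LabStar (Y ∷ Zs) w →
           LabStar (X ∷ Y ∷ Zs) (a ∷ w)

  QChain : ℕ → List C → Set
  QChain k Xs = Σ C λ X₀ → Σ (List C) λ Ys →
    Xs ≡ X₀ ∷ Ys × X₀ ≈C botC × length Ys ≡ k × Linked _⋖Q_ Xs

  QMax : List C → Set
  QMax Xs = Σ C λ X₀ → Σ (List C) λ Ys →
    Xs ≡ X₀ ∷ Ys × X₀ ≈C botC × Linked _⋖Q_ Xs × (∀ Z → ¬ (last⁺ X₀ Ys <Q Z))

  PChain : ℕ → List P → Set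
  PChain k c = Σ (List P) λ xs → c ≡ bot ∷ xs × length xs ≡ k × Linked _⋖_ c

  -- setoids: chains of Q_λ(P) are compared classwise (pointwise ≈C),
  -- chains of P by equality of their element lists
  QSetoid : (List C → Set) → Setoid 0ℓ 0ℓ
  QSetoid Pred = record
    { Carrier = Σ (List C) Pred
    ; _≈_ = λ a b → Pointwise _≈C_ (proj₁ a) (proj₁ b)
    ; isEquivalence = record
      { refl  = PW.isEquivalence ≈C-isEquivalence .IsEquivalence.refl
      ; sym   = PW.isEquivalence ≈C-isEquivalence .IsEquivalence.sym
      ; trans = PW.isEquivalence ≈C-isEquivalence .IsEquivalence.trans
      }
    }

  PSetoid : (List P → Set) → Setoid 0ℓ 0ℓ
  PSetoid Pred = record
    { Carrier = Σ (List P) Pred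
    ; _≈_ = λ a b → proj₁ a ≡ proj₁ b
    ; isEquivalence = record { refl = refl ; sym = sym ; trans = trans }
    }

module Submission where

-- A class X of Q_λ(P) has a well defined top e(X), since quadratic
-- exchanges fix the top element of a chain, and ∼_λ is compatible with
-- extending chains at the top.  In a graded poset, inclusion of saturated
-- chains from 0̂ means being a prefix; hence X ≤ Y in Q_λ(P) iff Y contains
-- an extension of a chain of X, and X ⋖ Y iff the extension adds exactly one
-- element.  Consequently a saturated chain X₀ ⋖ X₁ ⋖ ⋯ ⋖ X_k from [0̂] is
-- determined (up to classes) by the chain of tops 0̂ ⋖ e(X₁) ⋖ ⋯ ⋖ e(X_k) in P:
-- X_i is the class of the i-th prefix of that chain.  Conversely the classes of
-- the prefixes of any saturated chain of P form a saturated chain of Q_λ(P).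
-- The λ*-label of X_{i-1} ⋖ X_i is λ(e(X_{i-1}) ⋖ e(X_i)), because exchanges
-- permute the word of labels.  Maximality corresponds on both sides, because
-- in a finite poset every strict relation y < z starts with a cover y ⋖ w.

open import Defs
open import Level using (0ℓ)
open import Data.Nat using (ℕ; suc)
import Data.Nat as Nat
import Data.Nat.Properties as NatP
open import Data.List using (List; []; _∷_; _++_; length; map)
open import Data.List.Properties using (++-assoc; ++-identityʳ; length-++; ∷-injectiveʳ)
open import Data.List.Relation.Unary.Linked using (Linked; [-]; _∷_)
import Data.List.Relation.Unary.Linked as Linked
open import Data.List.Relation.Unary.Any using (here; there)
open import Data.List.Membership.Propositional using (_∈_)
open import Data.List.Membership.Propositional.Properties using (∈-++⁺ˡ)
open import Data.List.Relation.Binary.Pointwise using (Pointwise; []; _∷_)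
open import Data.List.Relation.Binary.Pointwise.Properties using (Pointwise-length)
open import Data.List.Relation.Binary.Permutation.Propositional
  using (_↭_; ↭-refl; ↭-isEquivalence; prep; swap; module PermutationReasoning)
open import Data.List.Relation.Binary.Permutation.Propositional.Properties using (++⁺ˡ; ++-comm)
open import Data.Product using (Σ; _×_; _,_; proj₁; proj₂)
open import Data.Empty using (⊥-elim)
open import Relation.Nullary using (¬_; yes; no)
open import Relation.Nullary.Decidable using (_×-dec_; ¬?)
open import Relation.Binary using (Rel)
open import Relation.Binary.PropositionalEquality
  using (_≡_; refl; sym; trans; cong; cong₂; subst; subst₂)
import Relation.Binary.PropositionalEquality as Eq
open import Relation.Binary.Construct.Closure.ReflexiveTransitive using (ε; _◅_)
open import Relation.Binary.Construct.Closure.Symmetric using (fwd; bwd)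
import Relation.Binary.Construct.Closure.Equivalence as EqC
open import Data.Fin using (_≟_)
open import Data.Fin.Properties using (any?)
open import Data.Fin.Induction using (po-wellFounded)
open import Induction.WellFounded using (Acc; acc)
open import Function.Bundles using (Bijection)

module _ {A : Set} where

  last⁺-++ : ∀ (x : A) xs r → last⁺ x (xs ++ r) ≡ last⁺ (last⁺ x xs) r
  last⁺-++ x []       r = refl
  last⁺-++ x (y ∷ ys) r = last⁺-++ y ys r

  last⁺-middle : ∀ (q : A) p x y s → last⁺ q (p ++ x ∷ y ∷ s) ≡ last⁺ y s
  last⁺-middle q []      x y s = refl
  last⁺-middle q (a ∷ p) x y s = last⁺-middle a p x y s

  -- tops e(c), words and exchanges are only meaningful for nonempty chains
  NonEmpty : List A → Set
  NonEmpty c = Σ A λ y → Σ (List A) λ ys → c ≡ y ∷ ys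

  nonEmpty-middle : ∀ (p : List A) x s → NonEmpty (p ++ x ∷ s)
  nonEmpty-middle []      x s = x , s , refl
  nonEmpty-middle (q ∷ p) x s = q , p ++ x ∷ s , refl

  nonEmpty-++ : ∀ {c : List A} r → NonEmpty c → NonEmpty (c ++ r)
  nonEmpty-++ r (y , ys , refl) = y , ys ++ r , refl

  suffix-after : ∀ (p p' : List A) {x u x₁ y₁ s s'} → length p ≡ suc (length p') →
    p ++ x ∷ s ≡ p' ++ u ∷ x₁ ∷ y₁ ∷ s' → s ≡ y₁ ∷ s'
  suffix-after (q ∷ [])     []       _   refl = refl
  suffix-after (q ∷ _ ∷ _)  []       ()  _
  suffix-after (q ∷ p)      (q' ∷ p') len eq =
    suffix-after p p' (NatP.suc-injective len) (∷-injectiveʳ eq)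

  module _ {R : Rel A 0ℓ} where

    Linked-++ : ∀ {x xs r} → Linked R (x ∷ xs) → Linked R (last⁺ x xs ∷ r) →
                Linked R (x ∷ xs ++ r)
    Linked-++ {xs = []}     _         l₂ = l₂
    Linked-++ {xs = y ∷ ys} (p ∷ l₁) l₂ = p ∷ Linked-++ l₁ l₂

    Linked-++ˡ : ∀ {x xs r} → Linked R (x ∷ xs ++ r) → Linked R (x ∷ xs)
    Linked-++ˡ {xs = []}     _       = [-]
    Linked-++ˡ {xs = y ∷ ys} (p ∷ l) = p ∷ Linked-++ˡ l

    Linked-++ʳ : ∀ {x xs r} → Linked R (x ∷ xs ++ r) → Linked R (last⁺ x xs ∷ r)
    Linked-++ʳ {xs = []}     l       = l
    Linked-++ʳ {xs = y ∷ ys} (_ ∷ l) = Linked-++ʳ l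

-- Chains of P, quadratic exchanges and the equivalence ∼_λ.
module Chains (D : LabeledPoset) where
  open LabeledPoset D using (_≤?_; isPartialOrder; lab)

  Saturated : List (P D) → Set
  Saturated = Linked (_⋖_ D)

  infix 4 _~_
  _~_ : Rel (List (P D)) 0ℓ
  _~_ = _∼_ D

  ~-refl : ∀ {c} → c ~ c
  ~-refl = ε

  ~-sym : ∀ {c d} → c ~ d → d ~ c
  ~-sym = EqC.symmetric (QExch D)

  ~-trans : ∀ {c d f} → c ~ d → d ~ f → c ~ f
  ~-trans = EqC.transitive (QExch D)

  cover-above : ∀ {y z} → _<_ D y z → Σ (P D) λ w → _⋖_ D y w
  cover-above {y} {z} = go z (po-wellFounded isPartialOrder z)
    where
      go : ∀ z → Acc (_<_ D) z → _<_ D y z → Σ (P D) λ w → _⋖_ D y w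
      go z (acc below) y<z
        with any? (λ w → ((y ≤? w) ×-dec ¬? (y ≟ w)) ×-dec ((w ≤? z) ×-dec ¬? (w ≟ z)))
      ... | yes (w , y<w , w<z) = go w (below w<z) y<w
      ... | no nothing-between  = z , y<z , λ w between → nothing-between (w , between)

  word-++ : ∀ {c} r → NonEmpty c → word D (c ++ r) ≡ word D c ++ word D (e D c ∷ r)
  word-++ r (x , xs , refl) = go x xs
    where
      go : ∀ x xs → word D (x ∷ xs ++ r) ≡ word D (x ∷ xs) ++ word D (last⁺ x xs ∷ r)
      go x []       = refl
      go x (y ∷ ys) = cong (lab x y ∷_) (go y ys)

  e-++ : ∀ {c} r → NonEmpty c → e D (c ++ r) ≡ last⁺ (e D c) r
  e-++ r (x , xs , refl) = last⁺-++ x xs r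

  saturated-++ : ∀ {c r} → NonEmpty c → Saturated c → Saturated (e D c ∷ r) → Saturated (c ++ r)
  saturated-++ (_ , _ , refl) = Linked-++

  saturated-++ʳ : ∀ {c r} → NonEmpty c → Saturated (c ++ r) → Saturated (e D c ∷ r)
  saturated-++ʳ (_ , _ , refl) = Linked-++ʳ

  -- a quadratic exchange changes one element which is not the top

  exch-nonEmpty : ∀ {i c d} → Exch D i c d → NonEmpty c × NonEmpty d
  exch-nonEmpty (_ , _ , _ , (p , x , x' , s , refl , refl , _) , _) =
    nonEmpty-middle p x s , nonEmpty-middle p x' s

  exch-length : ∀ {i c d} → Exch D i c d → length c ≡ length d
  exch-length (_ , _ , _ , (p , x , x' , s , refl , refl , _) , _) =
    trans (length-++ p) (sym (length-++ p))

  exch-word : ∀ {i c d} → Exch D i c d → word D c ↭ word D d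
  exch-word (_ , _ , _ , _ , (u , a , b , v , wc , wd , _)) =
    subst₂ _↭_ (sym wc) (sym wd) (++⁺ˡ u (swap a b ↭-refl))

  exch-top : ∀ {i c d} → Exch D i c d → e D c ≡ e D d
  exch-top (_ , _ , (p' , u , x₁ , y₁ , s' , c≡ , len' , _) , (p , x , x' , s , refl , refl , len) , _)
    with suffix-after p p' (trans len (sym len')) c≡
  ... | refl = e-middle p
    where
      e-middle : ∀ p → e D (p ++ x ∷ y₁ ∷ s') ≡ e D (p ++ x' ∷ y₁ ∷ s')
      e-middle []      = refl
      e-middle (q ∷ p) = trans (last⁺-middle q p x y₁ s') (sym (last⁺-middle q p x' y₁ s'))

  exch-++ʳ : ∀ {i c d} r → Saturated (e D c ∷ r) → Exch D i c d → Exch D i (c ++ r) (d ++ r)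
  exch-++ʳ {c = c} r lr
    ex@(lc , ld , (p' , u , x₁ , y₁ , s' , c≡ , len' , asc) ,
        (p , x , x' , s , refl , refl , len) , (w , a , b , v , wc , wd , lenw)) =
    saturated-++ nc lc lr ,
    saturated-++ nd ld (subst (λ t → Saturated (t ∷ r)) (exch-top ex) lr) ,
    (p' , u , x₁ , y₁ , s' ++ r , trans (cong (_++ r) c≡) (++-assoc p' _ r) , len' , asc) ,
    (p , x , x' , s ++ r , ++-assoc p (x ∷ s) r , ++-assoc p (x' ∷ s) r , len) ,
    (w , a , b , v ++ word D (e D c ∷ r) ,
      trans (word-++ r nc) (trans (cong (_++ _) wc) (++-assoc w (a ∷ b ∷ v) _)) ,
      trans (word-++ r nd)
        (trans (cong₂ (λ t f → t ++ word D (f ∷ r)) wd (sym (exch-top ex)))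
          (++-assoc w (b ∷ a ∷ v) _)) ,
      lenw)
    where
      nc = proj₁ (exch-nonEmpty ex)
      nd = proj₂ (exch-nonEmpty ex)

  ~-top : ∀ {c d} → c ~ d → e D c ≡ e D d
  ~-top = EqC.gfold Eq.isEquivalence (e D) (λ (_ , ex) → exch-top ex)

  ~-length : ∀ {c d} → c ~ d → length c ≡ length d
  ~-length = EqC.gfold Eq.isEquivalence length (λ (_ , ex) → exch-length ex)

  ~-word : ∀ {c d} → c ~ d → word D c ↭ word D d
  ~-word = EqC.gfold ↭-isEquivalence (word D) (λ (_ , ex) → exch-word ex)

  ~-++ʳ : ∀ r {c d} → Saturated (e D c ∷ r) → c ~ d → (c ++ r) ~ (d ++ r)
  ~-++ʳ r lr ε = ε
  ~-++ʳ r lr (fwd (i , ex) ◅ rest) =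
    fwd (i , exch-++ʳ r lr ex) ◅ ~-++ʳ r (subst (λ t → Saturated (t ∷ r)) (exch-top ex) lr) rest
  ~-++ʳ r lr (bwd (i , ex) ◅ rest) =
    bwd (i , exch-++ʳ r lr' ex) ◅ ~-++ʳ r lr' rest
    where lr' = subst (λ t → Saturated (t ∷ r)) (sym (exch-top ex)) lr

  Ext : List (P D) → List (P D) → List (P D) → Set
  Ext c r d = Saturated (c ++ r) × (c ++ r) ~ d

  ext-transport : ∀ {c c' r d} → NonEmpty c → Saturated c → NonEmpty c' →
                  c ~ c' → Ext c' r d → Ext c r d
  ext-transport {r = r} nc lc nc' c~c' (sat' , ext~d) =
    saturated-++ nc lc lr , ~-trans (~-++ʳ r lr c~c') ext~d
    where
      lr = subst (λ t → Saturated (t ∷ r)) (sym (~-top c~c')) (saturated-++ʳ nc' sat')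

  ext-join : ∀ c r₁ {r₂ d} → Ext (c ++ r₁) r₂ d → Ext c (r₁ ++ r₂) d
  ext-join c r₁ {r₂} {d} = subst (λ t → Saturated t × t ~ d) (++-assoc c r₁ r₂)

  ext-split : ∀ c r₁ {r₂ d} → Ext c (r₁ ++ r₂) d → Ext (c ++ r₁) r₂ d
  ext-split c r₁ {r₂} {d} = subst (λ t → Saturated t × t ~ d) (sym (++-assoc c r₁ r₂))

  ext-length : ∀ c r {d} → Ext c r d → length d ≡ length c Nat.+ length r
  ext-length c r (_ , ext~d) = trans (sym (~-length ext~d)) (length-++ c)

-- The order of Q_λ(P) and the representation of its chains by chains of P.
module Correspondence (D : LabeledPoset) (graded : IsGraded D) where
  open LabeledPoset D using (bot; lab)
  open Chains D

  ρ : P D → ℕ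
  ρ = proj₁ graded

  ρ-cover : ∀ {x y} → _⋖_ D x y → ρ y ≡ suc (ρ x)
  ρ-cover {x} {y} = proj₂ (proj₂ graded) x y

  ρ-above : ∀ {x l w} → Saturated (x ∷ l) → w ∈ l → ρ x Nat.< ρ w
  ρ-above (x⋖y ∷ _) (here refl) = NatP.≤-reflexive (sym (ρ-cover x⋖y))
  ρ-above (x⋖y ∷ l) (there m)   =
    NatP.<-trans (NatP.≤-reflexive (sym (ρ-cover x⋖y))) (ρ-above l m)

  member-tail : ∀ {x w l} → ρ x Nat.< ρ w → w ∈ x ∷ l → w ∈ l
  member-tail ρx<ρw (here refl) = ⊥-elim (NatP.<-irrefl refl ρx<ρw)
  member-tail _     (there m)   = m

  cover-member : ∀ {x a b l} → Saturated (x ∷ b ∷ l) → _⋖_ D x a → a ∈ b ∷ l → a ≡ b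
  cover-member _            _   (here a≡b) = a≡b
  cover-member (x⋖b ∷ lb) x⋖a (there m) =
    ⊥-elim (NatP.<-irrefl (trans (ρ-cover x⋖b) (sym (ρ-cover x⋖a))) (ρ-above lb m))

  prefix-of-superchain : ∀ x as bs → Saturated (x ∷ as) → Saturated (x ∷ bs) →
    (∀ {w} → w ∈ x ∷ as → w ∈ x ∷ bs) → Σ (List (P D)) λ r → bs ≡ as ++ r
  prefix-of-superchain x []       bs _ _ _ = bs , refl
  prefix-of-superchain x (a ∷ as) bs (x⋖a ∷ la) lb sub
    with member-tail (ρ-above (x⋖a ∷ la) (here refl)) (sub (there (here refl)))
  prefix-of-superchain x (a ∷ as) (b ∷ bs) (x⋖a ∷ la) (x⋖b ∷ lb) sub | a∈bs
    with cover-member (x⋖b ∷ lb) x⋖a a∈bs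
  ... | refl =
    let (r , eq) = prefix-of-superchain a as bs la lb sub' in r , cong (a ∷_) eq
    where
      sub' : ∀ {w} → w ∈ a ∷ as → w ∈ a ∷ bs
      sub' m = member-tail (ρ-above (x⋖a ∷ la) m) (sub (there m))

  nonEmptyC : (A : C D) → NonEmpty (proj₁ A)
  nonEmptyC (_ , xs , refl , _) = bot , xs , refl

  saturatedC : (A : C D) → Saturated (proj₁ A)
  saturatedC (_ , _ , _ , l) = l

  asC : ∀ xs → Saturated (bot ∷ xs) → C D
  asC xs l = bot ∷ xs , xs , refl , l

  ~⇒≈C : ∀ {A B : C D} → proj₁ A ~ proj₁ B → _≈C_ D A B
  ~⇒≈C A~B = ~-top A~B , A~B

  ext-of-prefix : ∀ {c r d} → d ≡ c ++ r → Saturated d → Ext c r d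
  ext-of-prefix refl l = l , ε

  -- A ≤ B in Q_λ(P) iff B is the class of an extension of A: a zigzag of
  -- inclusions (prefixes) and equivalences collapses to one extension

  zig⇒ext : ∀ {A B} → Zig D A B → Σ (List (P D)) λ r → Ext (proj₁ A) r (proj₁ B)
  zig⇒ext {A@(_ , as , refl , la)} {B@(_ , bs , refl , lb)} (base A⊆B)
    with prefix-of-superchain bot as bs la lb A⊆B
  ... | r , eq = r , ext-of-prefix {c = bot ∷ as} (cong (bot ∷_) eq) lb
  zig⇒ext {A@(_ , as , refl , la)} (step {b = B@(_ , bs , refl , lb)} {b' = B'} A⊆B (_ , B~B') zig)
    with zig⇒ext zig | prefix-of-superchain bot as bs la lb A⊆B
  ... | r , ext | r₁ , refl =
    r₁ ++ r , ext-join (proj₁ A) r₁ (ext-transport (nonEmptyC B) lb (nonEmptyC B') B~B' ext)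

  ≤Q⇒ext : ∀ {A B} → _≤Q_ D A B → Σ (List (P D)) λ r → Ext (proj₁ A) r (proj₁ B)
  ≤Q⇒ext {A} (X , Y , (_ , X~A) , (_ , Y~B) , zig) with zig⇒ext zig
  ... | r , ext with ext-transport {r = r} (nonEmptyC A) (saturatedC A) (nonEmptyC X) (~-sym X~A) ext
  ...   | sat , ext~Y = r , sat , ~-trans ext~Y Y~B

  ext⇒≤Q : ∀ (A B : C D) r → Ext (proj₁ A) r (proj₁ B) → _≤Q_ D A B
  ext⇒≤Q A@(_ , as , refl , _) B r (sat , ext~B) =
    A , asC (as ++ r) sat , ~⇒≈C {A} {A} ~-refl , ~⇒≈C {asC (as ++ r) sat} {B} ext~B , base ∈-++⁺ˡ

  <Q⇒ext : ∀ {A B} → _<Q_ D A B →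
           Σ (P D) λ z → Σ (List (P D)) λ r → Ext (proj₁ A) (z ∷ r) (proj₁ B)
  <Q⇒ext {A} {B} (A≤B , A≉B) with ≤Q⇒ext {A} {B} A≤B
  ... | [] , _ , A~B =
    ⊥-elim (A≉B (~⇒≈C {A} {B} (subst (_~ proj₁ B) (++-identityʳ (proj₁ A)) A~B)))
  ... | z ∷ r , ext = z , r , ext

  ext⇒<Q : ∀ (A B : C D) z r → Ext (proj₁ A) (z ∷ r) (proj₁ B) → _<Q_ D A B
  ext⇒<Q A B z r ext =
    ext⇒≤Q A B (z ∷ r) ext ,
    λ A≈B → NatP.m+1+n≢m (length (proj₁ A))
              (trans (sym (ext-length (proj₁ A) (z ∷ r) ext)) (sym (~-length (proj₂ A≈B))))

  <Q-length : ∀ {A B} → _<Q_ D A B → length (proj₁ A) Nat.< length (proj₁ B)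
  <Q-length {A} {B} A<B with <Q⇒ext {A} {B} A<B
  ... | z , r , ext =
    subst (length (proj₁ A) Nat.<_) (sym (ext-length (proj₁ A) (z ∷ r) ext))
      (NatP.m<m+n (length (proj₁ A)) (Nat.s≤s Nat.z≤n))

  -- adding one element at the top gives a cover of Q_λ(P), by lengths
  extend-cover : ∀ xs z l l' → _⋖Q_ D (asC xs l) (asC (xs ++ z ∷ []) l')
  extend-cover xs z l l' = ext⇒<Q A B z [] (l' , ε) , nothing-between
    where
      A = asC xs l
      B = asC (xs ++ z ∷ []) l'
      nothing-between : ∀ W → ¬ (_<Q_ D A W × _<Q_ D W B)
      nothing-between W (A<W , W<B) =
        NatP.<⇒≱ (<Q-length {A} {W} A<W)
          (NatP.m<1+n⇒m≤n (subst (length (proj₁ W) Nat.<_)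
            (trans (ext-length (proj₁ A) (z ∷ []) (l' , ε)) (NatP.+-comm (length (proj₁ A)) 1))
            (<Q-length {W} {B} W<B)))

  -- conversely a cover adds exactly one element: with more, the chain
  -- extended by the first one would lie strictly in between
  ⋖Q⇒ext : ∀ {A B} → _⋖Q_ D A B → Σ (P D) λ z → Ext (proj₁ A) (z ∷ []) (proj₁ B)
  ⋖Q⇒ext {A} {B} (A<B , nothing-between) with <Q⇒ext {A} {B} A<B
  ... | z , [] , ext = z , ext
  ⋖Q⇒ext {A@(_ , as , refl , _)} {B} (A<B , nothing-between) | z , w ∷ r , ext =
    ⊥-elim (nothing-between Z (ext⇒<Q A Z z [] (satZ , ε) , ext⇒<Q Z B w r extZ))
    where
      extZ : Ext (proj₁ A ++ z ∷ []) (w ∷ r) (proj₁ B)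
      extZ = ext-split (proj₁ A) (z ∷ []) ext
      satZ : Saturated (bot ∷ as ++ z ∷ [])
      satZ = Linked-++ˡ {xs = as ++ z ∷ []} (proj₁ extZ)
      Z = asC (as ++ z ∷ []) satZ

  prefixesFrom : List (P D) → List (P D) → List (List (P D))
  properPrefixesFrom : List (P D) → List (P D) → List (List (P D))
  prefixesFrom c r = c ∷ properPrefixesFrom c r
  properPrefixesFrom c []      = []
  properPrefixesFrom c (z ∷ r) = prefixesFrom (c ++ z ∷ []) r

  prefixesFrom-length : ∀ c r → length (prefixesFrom c r) ≡ suc (length r)
  prefixesFrom-length c []      = refl
  prefixesFrom-length c (z ∷ r) = cong suc (prefixesFrom-length (c ++ z ∷ []) r)

  infix 4 _≅_
  _≅_ : C D → List (P D) → Set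
  X ≅ c = proj₁ X ~ c

  chain-of-prefixes : ∀ {X Zs} → Linked (_⋖Q_ D) (X ∷ Zs) →
    ∀ c → NonEmpty c → Saturated c → X ≅ c →
    Σ (List (P D)) λ r → Saturated (c ++ r) × Pointwise _≅_ (X ∷ Zs) (prefixesFrom c r)
  chain-of-prefixes {Zs = []} _ c _ sat X≅c =
    [] , subst Saturated (sym (++-identityʳ c)) sat , X≅c ∷ []
  chain-of-prefixes {X} {Y ∷ _} (X⋖Y ∷ chain) c nc sat X≅c
    with ⋖Q⇒ext {X} {Y} X⋖Y
  ... | z , X→Y with ext-transport nc sat (nonEmptyC X) (~-sym X≅c) X→Y
  ...   | satz , cz~Y with chain-of-prefixes chain (c ++ z ∷ []) (nonEmpty-++ _ nc) satz (~-sym cz~Y)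
  ...     | r , satr , pw = z ∷ r , subst Saturated (++-assoc c (z ∷ []) r) satr , X≅c ∷ pw

  tops : List (C D) → List (P D)
  tops = map (λ X → e D (proj₁ X))

  tops-prefixes : ∀ {Xs} c r → NonEmpty c → Pointwise _≅_ Xs (prefixesFrom c r) →
                  tops Xs ≡ e D c ∷ r
  tops-prefixes c []      _  (X≅c ∷ []) = cong (_∷ []) (~-top X≅c)
  tops-prefixes c (z ∷ r) nc (X≅c ∷ pw) =
    cong₂ _∷_ (~-top X≅c)
      (trans (tops-prefixes (c ++ z ∷ []) r (nonEmpty-++ _ nc) pw) (cong (_∷ r) (e-++ (z ∷ []) nc)))

  last-prefixes : ∀ {X Ys} c r → Pointwise _≅_ (X ∷ Ys) (prefixesFrom c r) → last⁺ X Ys ≅ c ++ r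
  last-prefixes {X} c [] (X≅c ∷ []) = subst (X ≅_) (sym (++-identityʳ c)) X≅c
  last-prefixes {Ys = Y ∷ Ys} c (z ∷ r) (_ ∷ pw) =
    subst (last⁺ Y Ys ≅_) (++-assoc c (z ∷ []) r) (last-prefixes (c ++ z ∷ []) r pw)

  new-label : ∀ X Y c z → NonEmpty c → X ≅ c → Y ≅ c ++ z ∷ [] →
              S D Y ↭ lab (e D c) z ∷ S D X
  new-label X Y c z nc X≅c Y≅cz = begin
    word D (proj₁ Y)                  ↭⟨ ~-word Y≅cz ⟩
    word D (c ++ z ∷ [])              ≡⟨ word-++ (z ∷ []) nc ⟩
    word D c ++ lab (e D c) z ∷ []    ↭⟨ ++-comm (word D c) _ ⟩
    lab (e D c) z ∷ word D c          ↭⟨ prep _ (~-word (~-sym X≅c)) ⟩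
    lab (e D c) z ∷ word D (proj₁ X)  ∎
    where open PermutationReasoning

  labels-prefixes : ∀ {Xs} c r → NonEmpty c → Pointwise _≅_ Xs (prefixesFrom c r) →
                    LabStar D Xs (word D (e D c ∷ r))
  labels-prefixes c [] _ (_ ∷ []) = one
  labels-prefixes {X ∷ Y ∷ Zs} c (z ∷ r) nc (X≅c ∷ pw@(Y≅cz ∷ _)) =
    step (new-label X Y c z nc X≅c Y≅cz)
      (subst (λ t → LabStar D (Y ∷ Zs) (word D (t ∷ r))) (e-++ (z ∷ []) nc)
        (labels-prefixes (c ++ z ∷ []) r (nonEmpty-++ _ nc) pw))

  QSaturated : List (C D) → Set
  QSaturated Xs = Σ (C D) λ X₀ → Σ (List (C D)) λ Ys →
    Xs ≡ X₀ ∷ Ys × _≈C_ D X₀ (botC D) × Linked (_⋖Q_ D) Xs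

  RepresentedBy : List (C D) → List (P D) → Set
  RepresentedBy Xs r = Saturated (bot ∷ r) × Pointwise _≅_ Xs (prefixesFrom (bot ∷ []) r)

  represent : ∀ {Xs} → QSaturated Xs → Σ (List (P D)) λ r → RepresentedBy Xs r
  represent (_ , _ , refl , (_ , X₀~0̂) , chain) =
    chain-of-prefixes chain (bot ∷ []) (bot , [] , refl) [-] X₀~0̂

  rep-tops : ∀ {Xs r} → RepresentedBy Xs r → tops Xs ≡ bot ∷ r
  rep-tops {r = r} (_ , pw) = tops-prefixes (bot ∷ []) r (bot , [] , refl) pw

  rep-length : ∀ {X Ys r} → RepresentedBy (X ∷ Ys) r → length Ys ≡ length r
  rep-length {r = r} (_ , pw) =
    NatP.suc-injective (trans (Pointwise-length pw) (prefixesFrom-length (bot ∷ []) r))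

  rep-labels : ∀ {Xs r} → RepresentedBy Xs r → LabStar D Xs (word D (bot ∷ r))
  rep-labels {r = r} (_ , pw) = labels-prefixes (bot ∷ []) r (bot , [] , refl) pw

  rep-last : ∀ {X Ys r} → RepresentedBy (X ∷ Ys) r → last⁺ X Ys ≅ bot ∷ r
  rep-last {r = r} (_ , pw) = last-prefixes (bot ∷ []) r pw

  rep-unique : ∀ {Xs Xs' r} → RepresentedBy Xs r → RepresentedBy Xs' r → Pointwise (_≈C_ D) Xs Xs'
  rep-unique (_ , pw) (_ , pw') = go pw pw'
    where
      go : ∀ {Xs Xs' cs} → Pointwise _≅_ Xs cs → Pointwise _≅_ Xs' cs → Pointwise (_≈C_ D) Xs Xs'
      go []          []            = []
      go {X ∷ _} {X' ∷ _} (X≅c ∷ pw) (X'≅c ∷ pw') = ~⇒≈C {X} {X'} (~-trans X≅c (~-sym X'≅c)) ∷ go pw pw'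

  tops-cong : ∀ {Xs Ys} → Pointwise (_≈C_ D) Xs Ys → tops Xs ≡ tops Ys
  tops-cong []               = refl
  tops-cong ((top≡ , _) ∷ p) = cong₂ _∷_ top≡ (tops-cong p)

  reassoc : ∀ xs z r → Saturated (bot ∷ xs ++ z ∷ r) → Saturated (bot ∷ (xs ++ z ∷ []) ++ r)
  reassoc xs z r = subst (λ t → Saturated (bot ∷ t)) (sym (++-assoc xs (z ∷ []) r))

  classesOfPrefixes : ∀ xs r → Saturated (bot ∷ xs ++ r) → List (C D)
  classesOfProperPrefixes : ∀ xs r → Saturated (bot ∷ xs ++ r) → List (C D)
  classesOfPrefixes xs r sat = asC xs (Linked-++ˡ sat) ∷ classesOfProperPrefixes xs r sat
  classesOfProperPrefixes xs []      sat = []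
  classesOfProperPrefixes xs (z ∷ r) sat = classesOfPrefixes (xs ++ z ∷ []) r (reassoc xs z r sat)

  classes-saturated : ∀ xs r sat → Linked (_⋖Q_ D) (classesOfPrefixes xs r sat)
  classes-saturated xs []      sat = [-]
  classes-saturated xs (z ∷ r) sat =
    extend-cover xs z (Linked-++ˡ sat) (Linked-++ˡ (reassoc xs z r sat)) ∷
    classes-saturated (xs ++ z ∷ []) r (reassoc xs z r sat)

  classes-prefixes : ∀ xs r sat → Pointwise _≅_ (classesOfPrefixes xs r sat) (prefixesFrom (bot ∷ xs) r)
  classes-prefixes xs []      sat = ε ∷ []
  classes-prefixes xs (z ∷ r) sat = ε ∷ classes-prefixes (xs ++ z ∷ []) r (reassoc xs z r sat)

  realise : ∀ r → Saturated (bot ∷ r) → Σ (List (C D)) λ Xs → QSaturated Xs × RepresentedBy Xs r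
  realise r sat =
    classesOfPrefixes [] r sat ,
    (_ , _ , refl , (refl , ε) , classes-saturated [] r sat) ,
    sat , classes-prefixes [] r sat

  maximal-top : ∀ {X r} → X ≅ bot ∷ r → Saturated (bot ∷ r) →
                (∀ Z → ¬ _<Q_ D X Z) → ∀ z → ¬ _<_ D (last⁺ bot r) z
  maximal-top {X} {r} X≅c sat X-max z top<z with cover-above top<z
  ... | w , top⋖w =
    X-max Z (ext⇒<Q X Z w [] (ext-transport (nonEmptyC X) (saturatedC X) (bot , r , refl) X≅c (satw , ε)))
    where
      satw : Saturated (bot ∷ r ++ w ∷ [])
      satw = Linked-++ sat (top⋖w ∷ [-])
      Z = asC (r ++ w ∷ []) satw

  maximal-class : ∀ {X r} → X ≅ bot ∷ r → Saturated (bot ∷ r) →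
                  (∀ z → ¬ _<_ D (last⁺ bot r) z) → ∀ Z → ¬ _<Q_ D X Z
  maximal-class {X} {r} X≅c sat top-max Z X<Z with <Q⇒ext {X} {Z} X<Z
  ... | z , _ , ext with ext-transport (bot , r , refl) sat (nonEmptyC X) (~-sym X≅c) ext
  ...   | sat' , _ = top-max z (proj₁ (Linked.head (Linked-++ʳ {xs = r} sat')))

  LabelPreservingBijection : (List (C D) → Set) → (List (P D) → Set) → Set
  LabelPreservingBijection QP PP = Σ (Bijection (QSetoid D QP) (PSetoid D PP)) λ f →
    ∀ X → LabStar D (proj₁ X) (word D (proj₁ (Bijection.to f X)))

  module _ (QP : List (C D) → Set) (PP : List (P D) → Set)
           (qsat : ∀ {Xs} → QP Xs → QSaturated Xs)
           (psat : ∀ {c} → PP c → IsC D c)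
           (toPP : ∀ {Xs r} → QP Xs → RepresentedBy Xs r → PP (bot ∷ r))
           (fromPP : ∀ {Xs r} → PP (bot ∷ r) → QSaturated Xs → RepresentedBy Xs r → QP Xs) where

    topsOf : Σ (List (C D)) QP → Σ (List (P D)) PP
    topsOf (Xs , q) = tops Xs , subst PP (sym (rep-tops rep)) (toPP q rep)
      where rep = proj₂ (represent (qsat q))

    topsOf-injective : ∀ {a b} → tops (proj₁ a) ≡ tops (proj₁ b) → Pointwise (_≈C_ D) (proj₁ a) (proj₁ b)
    topsOf-injective {_ , q} {_ , q'} eq with represent (qsat q) | represent (qsat q')
    ... | _ , rep | _ , rep' with ∷-injectiveʳ (trans (sym (rep-tops rep)) (trans eq (rep-tops rep')))
    ...   | refl = rep-unique rep rep'

    topsOf-surjective : ∀ (y : Σ (List (P D)) PP) → Σ (Σ (List (C D)) QP) λ x →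
      ∀ {z : Σ (List (C D)) QP} → Pointwise (_≈C_ D) (proj₁ z) (proj₁ x) → tops (proj₁ z) ≡ proj₁ y
    topsOf-surjective (_ , p) with psat p
    ... | r , refl , sat with realise r sat
    ...   | Xs , qs , rep = (Xs , fromPP p qs rep) , λ z≈Xs → trans (tops-cong z≈Xs) (rep-tops rep)

    correspondence : LabelPreservingBijection QP PP
    correspondence =
      record { to        = topsOf
             ; cong      = λ {a} {b} → tops-cong {proj₁ a} {proj₁ b}
             ; bijective = (λ {a} {b} → topsOf-injective {a} {b}) , topsOf-surjective } ,
      λ (Xs , q) → let rep = proj₂ (represent (qsat q)) in
        subst (λ t → LabStar D Xs (word D t)) (sym (rep-tops rep)) (rep-labels rep)

  -- saturated chains of length k: representation preserves length
  chains-of-length : ∀ k → LabelPreservingBijection (QChain D k) (PChain D k)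
  chains-of-length k = correspondence (QChain D k) (PChain D k) qsat psat toPP fromPP
    where
      qsat : ∀ {Xs} → QChain D k Xs → QSaturated Xs
      qsat (X₀ , Ys , eq , h , _ , chain) = X₀ , Ys , eq , h , chain
      psat : ∀ {c} → PChain D k c → IsC D c
      psat (xs , eq , _ , sat) = xs , eq , sat
      toPP : ∀ {Xs r} → QChain D k Xs → RepresentedBy Xs r → PChain D k (bot ∷ r)
      toPP {r = r} (_ , _ , refl , _ , len , _) rep = r , refl , trans (sym (rep-length rep)) len , proj₁ rep
      fromPP : ∀ {Xs r} → PChain D k (bot ∷ r) → QSaturated Xs → RepresentedBy Xs r → QChain D k Xs
      fromPP (_ , refl , len , _) (X₀ , Ys , refl , h , chain) rep =
        X₀ , Ys , refl , h , trans (rep-length rep) len , chain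

  -- maximal chains: representation preserves maximality
  maximal-chains : LabelPreservingBijection (QMax D) (MaximalChain D)
  maximal-chains = correspondence (QMax D) (MaximalChain D) qsat psat toPP fromPP
    where
      qsat : ∀ {Xs} → QMax D Xs → QSaturated Xs
      qsat (X₀ , Ys , eq , h , chain , _) = X₀ , Ys , eq , h , chain
      psat : ∀ {c} → MaximalChain D c → IsC D c
      psat (_ , (xs , eq , sat , _) , _) = xs , eq , sat
      toPP : ∀ {Xs r} → QMax D Xs → RepresentedBy Xs r → MaximalChain D (bot ∷ r)
      toPP {r = r} (X₀ , Ys , refl , _ , _ , X-max) rep =
        last⁺ bot r , (r , refl , proj₁ rep , refl) ,
        maximal-top {last⁺ X₀ Ys} (rep-last rep) (proj₁ rep) X-max
      fromPP : ∀ {Xs r} → MaximalChain D (bot ∷ r) → QSaturated Xs → RepresentedBy Xs r → QMax D Xs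
      fromPP (_ , (_ , refl , sat , refl) , top-max) (X₀ , Ys , refl , h , chain) rep =
        X₀ , Ys , refl , h , chain , maximal-class {last⁺ X₀ Ys} (rep-last rep) sat top-max

proposition3p26 : (D : LabeledPoset) → IsMinimum D → IsGraded D → IsGeneralizedEW D →
    ((k : ℕ) → Σ (Bijection (QSetoid D (QChain D k)) (PSetoid D (PChain D k))) λ f →
        ∀ X → LabStar D (proj₁ X) (word D (proj₁ (Bijection.to f X))))
    × Σ (Bijection (QSetoid D (QMax D)) (PSetoid D (MaximalChain D))) λ f →
        ∀ X → LabStar D (proj₁ X) (word D (proj₁ (Bijection.to f X)))
proposition3p26 D _ graded _ = chains-of-length , maximal-chains
  where open Correspondence D graded
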